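{- Let $v$ be a positive integer and $b\in\mathbb{N}$ with $b<2^v$. Suppose the binary digit expansion of $\Phi(\bar{b}_{v,\infty})$ is $r_0r_1\cdots r_{u-1}\overline{r_ur_{u+1}\cdots r_{u+p-1}}$ (i.e. $r_{i+p}=r_i$ for all $i\geq u$), and choose $t\in\mathbb{N}$ with $tv\geq u$. Then for every positive integer $H$, $$R_{tv}\left(\Phi\left(\bar{b}_{v,t}\right)\right)\equiv R_{(t+p2^H)v}\left(\Phi\left(\bar{b}_{v,t+p2^H}\right)\right)\pmod{2^{H+2}}.$$
   Context: $\mathbb{Z}_2$ is the ring of $2$-adic integers; $\mathbb{N}=\{0,1,2,\dots\}$. Every $x\in\mathbb{Z}_2$ has a unique expansion $x=\sum_{i\geq0}d_i2^i$ with $d_i\in\{0,1\}$, written $x=d_0d_1d_2\cdots$; an overline denotes a block of digits repeated forever. The map $\Phi:\mathbb{Z}_2\to\mathbb{Z}_2$ is defined as follows: if $x=\sum_i 2^{e_i}$ with $0\leq e_0<e_1<\cdots$ (finite or infinite sum; $x=0$ is the empty sum), then $\Phi(x)=-\sum_i 2^{e_i}3^{ -i}$ ($\Phi(0)=0$). For $x\in\mathbb{Z}_2$ and $c\in\mathbb{N}$, $R_c(x)=d_cd_{c+1}\cdots=\sum_{i\geq0}d_{c+i}2^i$. For $b,v,t\in\mathbb{N}$, $\bar{b}_{v,t}=b\sum_{i=0}^{t-1}2^{vi}$ and $\bar{b}_{v,\infty}=b\sum_{i=0}^{\infty}2^{vi}$. -}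

module Defs where

open import Data.Nat using (ℕ; zero; suc; _+_; _*_; _∸_; _^_; _/_; _%_)
open import Data.Nat.Properties using (m^n≢0)

sumTo : ℕ → (ℕ → ℕ) → ℕ
sumTo zero    f = 0
sumTo (suc n) f = sumTo n f + f n

mod2^ : ℕ → ℕ → ℕ
mod2^ x N = _%_ x (2 ^ N) {{m^n≢0 2 N}}

bit : ℕ → ℕ → ℕ
bit n e = (_/_ n (2 ^ e) {{m^n≢0 2 e}}) % 2

-- 2-adic integers, represented by their digit sequences x = d₀d₁d₂⋯
-- (each d i is meant to be 0 or 1)
ℤ₂ : Set
ℤ₂ = ℕ → ℕ

ι : ℕ → ℤ₂
ι n = bit n

trunc : ℤ₂ → ℕ → ℕ
trunc x N = sumTo N (λ k → x k * 2 ^ k)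

_≡₂_mod2^_ : ℤ₂ → ℤ₂ → ℕ → Set
x ≡₂ y mod2^ m = trunc x m ≡ trunc y m
  where open import Relation.Binary.PropositionalEquality using (_≡_)

R : ℕ → ℤ₂ → ℤ₂
R c x i = x (c + i)

-- an inverse of 3 modulo 2^N:  3 · (2·4^N+1)/3 = 2·4^N + 1 ≡ 1 (mod 2^N)
inv3 : ℕ → ℕ
inv3 N = (2 * 4 ^ N + 1) / 3

-- number of 1-digits of n in positions < e  (= index i of the exponent e = e_i)
popBelow : ℕ → ℕ → ℕ
popBelow n e = sumTo e (bit n)

-- Φ(n) mod 2^N for a natural number n = Σ_i 2^{e_i}:
--   Φ(n) = - Σ_i 2^{e_i} 3^{-i}, computed mod 2^N with 3^{-1} ↦ inv3 N.
-- (Exponents e range over e < n, enough since n < 2^n.)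
phiMod : ℕ → ℕ → ℕ
phiMod N n = mod2^ (2 ^ N ∸ mod2^ S N) N
  where
  S : ℕ
  S = sumTo n (λ e → bit n e * 2 ^ e * inv3 N ^ popBelow n e)

-- Φ : ℤ₂ → ℤ₂.  Digit j of Φ(x) is digit j of Φ(x) mod 2^{j+1}; since
-- terms with e_i ≥ j+1 are divisible by 2^{j+1}, Φ(x) ≡ Φ(x mod 2^{j+1}) (mod 2^{j+1}).
Φ : ℤ₂ → ℤ₂
Φ x j = bit (phiMod (suc j) (trunc x (suc j))) j

barFin : ℕ → ℕ → ℕ → ℕ
barFin b v t = b * sumTo t (λ i → 2 ^ (v * i))

-- b̄_{v,∞} = b Σ_{i≥0} 2^{vi} ∈ ℤ₂ (for v ≥ 1): its digit k equals digit k
-- of the partial sum with k+1 terms, since 2^{v i} ≥ 2^{k+1} for i ≥ k+1.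
barInf : ℕ → ℕ → ℤ₂
barInf b v k = bit (barFin b v (suc k)) k

{-# OPTIONS --safe #-}
-- For x < 2^c one has Φ(x + 2^c y) = Φ(x) + 2^c 3^{-popBelow x c} Φ(y), since the exponents of
-- y are shifted by c and their indices by the number of ones of x.  As b̄_{v,∞} = b̄_{v,t} + 2^{tv} b̄_{v,∞}
-- and b̄_{v,t} has t·k ones (k the number of ones of b), shifting by tv digits gives
--   R_{tv} Φ(b̄_{v,∞}) = R_{tv} Φ(b̄_{v,t}) + 3^{-tk} Φ(b̄_{v,∞}).
-- Replacing t by t + p 2^H leaves the left side unchanged by periodicity, and changes 3^{-tk} only by a
-- power of 3^{2^H} ≡ 1 (mod 2^{H+2}).  All of this is carried out on residues modulo 2^N, where 3^{-1}
-- is represented by inv3 N.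
module Submission where

open import Defs
open import Data.Nat
open import Data.Nat.Properties
open import Data.Nat.DivMod hiding (_mod_)
open import Data.Nat.Divisibility using (_∣_; divides; ∣m∣n⇒∣m+n; m∣m*n)
open import Data.Nat.Tactic.RingSolver using (solve-∀)
open import Data.Product using (_×_; _,_; proj₂)
open import Level using (0ℓ)
open import Relation.Binary.Bundles using (Setoid)
open import Relation.Binary.Structures using (IsEquivalence)
open import Relation.Binary.PropositionalEquality
import Relation.Binary.Reasoning.Setoid as SetoidReasoning
open import Function using (_∘_)

-- Congruence modulo m

infix 4 _≡_mod_

-- Witnessed without subtraction.
record _≡_mod_ (a b m : ℕ) : Set where
  constructor mk≡mod
  field
    k l : ℕ
    eq  : a + k * m ≡ b + l * m

module _ {m : ℕ} where

  ≡⇒≡mod : ∀ {a b} → a ≡ b → a ≡ b mod m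
  ≡⇒≡mod refl = mk≡mod 0 0 refl

  ≡mod-sym : ∀ {a b} → a ≡ b mod m → b ≡ a mod m
  ≡mod-sym (mk≡mod k l e) = mk≡mod l k (sym e)

  ≡mod-trans : ∀ {a b c} → a ≡ b mod m → b ≡ c mod m → a ≡ c mod m
  ≡mod-trans {a} {b} {c} (mk≡mod k l e) (mk≡mod k′ l′ e′) = mk≡mod (k + k′) (l′ + l) (begin
    a + (k + k′) * m    ≡⟨ shuffle a k k′ m ⟩
    a + k * m + k′ * m  ≡⟨ cong (_+ k′ * m) e ⟩
    b + l * m + k′ * m  ≡⟨ shuffle′ b l k′ m ⟩
    b + k′ * m + l * m  ≡⟨ cong (_+ l * m) e′ ⟩
    c + l′ * m + l * m  ≡⟨ shuffle c l′ l m ⟨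
    c + (l′ + l) * m    ∎)
    where
    open ≡-Reasoning
    shuffle : ∀ a k k′ m → a + (k + k′) * m ≡ a + k * m + k′ * m
    shuffle = solve-∀
    shuffle′ : ∀ b l k′ m → b + l * m + k′ * m ≡ b + k′ * m + l * m
    shuffle′ = solve-∀

  ≡mod-isEquivalence : IsEquivalence (λ a b → a ≡ b mod m)
  ≡mod-isEquivalence = record { refl = ≡⇒≡mod refl ; sym = ≡mod-sym ; trans = ≡mod-trans }

  +-cong-≡mod : ∀ {a b c d} → a ≡ b mod m → c ≡ d mod m → a + c ≡ b + d mod m
  +-cong-≡mod {a} {b} {c} {d} (mk≡mod k l e) (mk≡mod k′ l′ e′) = mk≡mod (k + k′) (l + l′) (begin
    a + c + (k + k′) * m        ≡⟨ shuffle a c k k′ m ⟩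
    (a + k * m) + (c + k′ * m)  ≡⟨ cong₂ _+_ e e′ ⟩
    (b + l * m) + (d + l′ * m)  ≡⟨ shuffle b d l l′ m ⟨
    b + d + (l + l′) * m        ∎)
    where
    open ≡-Reasoning
    shuffle : ∀ a c k k′ m → a + c + (k + k′) * m ≡ (a + k * m) + (c + k′ * m)
    shuffle = solve-∀

  *-congˡ-≡mod : ∀ c {a b} → a ≡ b mod m → c * a ≡ c * b mod m
  *-congˡ-≡mod c {a} {b} (mk≡mod k l e) = mk≡mod (c * k) (c * l) (begin
    c * a + c * k * m  ≡⟨ distrib c a k m ⟩
    c * (a + k * m)    ≡⟨ cong (c *_) e ⟩
    c * (b + l * m)    ≡⟨ distrib c b l m ⟨
    c * b + c * l * m  ∎)
    where
    open ≡-Reasoning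
    distrib : ∀ c a k m → c * a + c * k * m ≡ c * (a + k * m)
    distrib = solve-∀

  *-congʳ-≡mod : ∀ c {a b} → a ≡ b mod m → a * c ≡ b * c mod m
  *-congʳ-≡mod c {a} {b} = subst₂ (_≡_mod m) (*-comm c a) (*-comm c b) ∘ *-congˡ-≡mod c

  *-cong-≡mod : ∀ {a b c d} → a ≡ b mod m → c ≡ d mod m → a * c ≡ b * d mod m
  *-cong-≡mod {a} {d = d} a≡b c≡d = ≡mod-trans (*-congˡ-≡mod a c≡d) (*-congʳ-≡mod d a≡b)

  ^-cong-≡mod : ∀ n {a b} → a ≡ b mod m → a ^ n ≡ b ^ n mod m
  ^-cong-≡mod zero    _   = ≡⇒≡mod refl
  ^-cong-≡mod (suc n) a≡b = *-cong-≡mod a≡b (^-cong-≡mod n a≡b)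

  +-cancelʳ-≡mod : ∀ c {a b} → a + c ≡ b + c mod m → a ≡ b mod m
  +-cancelʳ-≡mod c {a} {b} (mk≡mod k l e) = mk≡mod k l (+-cancelʳ-≡ c _ _ (begin
    a + k * m + c  ≡⟨ swap a (k * m) c ⟩
    a + c + k * m  ≡⟨ e ⟩
    b + c + l * m  ≡⟨ swap b (l * m) c ⟨
    b + l * m + c  ∎))
    where
    open ≡-Reasoning
    swap : ∀ a x c → a + x + c ≡ a + c + x
    swap = solve-∀

  +-cancelˡ-≡mod : ∀ c {a b} → c + a ≡ c + b mod m → a ≡ b mod m
  +-cancelˡ-≡mod c {a} {b} = +-cancelʳ-≡mod c ∘ subst₂ (_≡_mod m) (+-comm c a) (+-comm c b)

  m*≡0 : ∀ q → m * q ≡ 0 mod m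
  m*≡0 q = mk≡mod 0 q (trans (+-identityʳ (m * q)) (*-comm m q))

  +m*≡ : ∀ a q → a + m * q ≡ a mod m
  +m*≡ a q = subst (a + m * q ≡_mod m) (+-identityʳ a) (+-cong-≡mod (≡⇒≡mod refl) (m*≡0 q))

  ≡mod-weaken : ∀ {a b} n → a ≡ b mod m * n → a ≡ b mod m
  ≡mod-weaken {a} {b} n (mk≡mod k l e) = mk≡mod (k * n) (l * n) (begin
    a + k * n * m  ≡⟨ cong (a +_) (reassoc k n m) ⟩
    a + k * (m * n) ≡⟨ e ⟩
    b + l * (m * n) ≡⟨ cong (b +_) (reassoc l n m) ⟨
    b + l * n * m  ∎)
    where
    open ≡-Reasoning
    reassoc : ∀ k n m → k * n * m ≡ k * (m * n)
    reassoc = solve-∀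

  ≡mod-lift : ∀ c {a b} → a ≡ b mod m → c * a ≡ c * b mod c * m
  ≡mod-lift c {a} {b} (mk≡mod k l e) = mk≡mod k l (begin
    c * a + k * (c * m)  ≡⟨ distrib c a k m ⟩
    c * (a + k * m)      ≡⟨ cong (c *_) e ⟩
    c * (b + l * m)      ≡⟨ distrib c b l m ⟨
    c * b + l * (c * m)  ∎)
    where
    open ≡-Reasoning
    distrib : ∀ c a k m → c * a + k * (c * m) ≡ c * (a + k * m)
    distrib = solve-∀

  ≡mod-unlift : ∀ c .{{_ : NonZero c}} {a b} → c * a ≡ c * b mod c * m → a ≡ b mod m
  ≡mod-unlift c {a} {b} (mk≡mod k l e) = mk≡mod k l (*-cancelˡ-≡ _ _ c (begin
    c * (a + k * m)      ≡⟨ distrib c a k m ⟨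
    c * a + k * (c * m)  ≡⟨ e ⟩
    c * b + l * (c * m)  ≡⟨ distrib c b l m ⟩
    c * (b + l * m)      ∎))
    where
    open ≡-Reasoning
    distrib : ∀ c a k m → c * a + k * (c * m) ≡ c * (a + k * m)
    distrib = solve-∀

  module _ .{{_ : NonZero m}} where

    %≡mod : ∀ a → a % m ≡ a mod m
    %≡mod a = mk≡mod (a / m) 0 (trans (sym (m≡m%n+[m/n]*n a m)) (sym (+-identityʳ a)))

    ≡mod⇒%≡ : ∀ {a b} → a ≡ b mod m → a % m ≡ b % m
    ≡mod⇒%≡ {a} {b} (mk≡mod k l e) = begin
      a % m            ≡⟨ [m+kn]%n≡m%n a k m ⟨
      (a + k * m) % m  ≡⟨ cong (_% m) e ⟩
      (b + l * m) % m  ≡⟨ [m+kn]%n≡m%n b l m ⟩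
      b % m            ∎
      where open ≡-Reasoning

    ≡mod⇒≡ : ∀ {a b} → a < m → b < m → a ≡ b mod m → a ≡ b
    ≡mod⇒≡ a<m b<m a≡b = trans (sym (m<n⇒m%n≡m a<m)) (trans (≡mod⇒%≡ a≡b) (m<n⇒m%n≡m b<m))

≡mod-modulus : ∀ {a b m n} → m ≡ n → a ≡ b mod m → a ≡ b mod n
≡mod-modulus refl a≡b = a≡b

≡mod-setoid : ℕ → Setoid 0ℓ 0ℓ
≡mod-setoid m = record { isEquivalence = ≡mod-isEquivalence {m} }

module ≡mod-Reasoning (m : ℕ) = SetoidReasoning (≡mod-setoid m)

≡mod-2^-weaken : ∀ {M N a b} → M ≤ N → a ≡ b mod 2 ^ N → a ≡ b mod 2 ^ M
≡mod-2^-weaken {M} M≤N a≡b with m≤n⇒∃[o]m+o≡n M≤N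
... | d , refl = ≡mod-weaken (2 ^ d) (≡mod-modulus (^-distribˡ-+-* 2 M d) a≡b)

≡mod-2^-lift : ∀ c {M a b} → a ≡ b mod 2 ^ M → 2 ^ c * a ≡ 2 ^ c * b mod 2 ^ (c + M)
≡mod-2^-lift c {M} = ≡mod-modulus (sym (^-distribˡ-+-* 2 c M)) ∘ ≡mod-lift (2 ^ c)

≡mod-radix : ∀ {m n a a′ b b′} .{{_ : NonZero m}} → a < m → a′ < m →
             a + m * b ≡ a′ + m * b′ mod m * n → a ≡ a′ × (b ≡ b′ mod n)
≡mod-radix {m} {n} {a} {a′} {b} {b′} a<m a′<m eq = a≡a′ , ≡mod-unlift m (+-cancelˡ-≡mod a eq′)
  where
  a≡a′ : a ≡ a′
  a≡a′ = ≡mod⇒≡ a<m a′<m (begin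
    a             ≈⟨ +m*≡ a b ⟨
    a + m * b     ≈⟨ ≡mod-weaken n eq ⟩
    a′ + m * b′   ≈⟨ +m*≡ a′ b′ ⟩
    a′            ∎)
    where open ≡mod-Reasoning m
  eq′ : a + m * b ≡ a + m * b′ mod m * n
  eq′ = subst (λ z → a + m * b ≡ z + m * b′ mod m * n) (sym a≡a′) eq

^-distrib-* : ∀ a b n → (a * b) ^ n ≡ a ^ n * b ^ n
^-distrib-* a b zero    = refl
^-distrib-* a b (suc n) = trans (cong (a * b *_) (^-distrib-* a b n)) (interchange a b (a ^ n) (b ^ n))
  where interchange : ∀ a b x y → a * b * (x * y) ≡ a * x * (b * y)
        interchange = solve-∀

inverse-unique-≡mod : ∀ {m c a b} → c * a ≡ 1 mod m → c * b ≡ 1 mod m → a ≡ b mod m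
inverse-unique-≡mod {m} {c} {a} {b} ca≡1 cb≡1 = begin
  a              ≡⟨ *-identityʳ a ⟨
  a * 1          ≈⟨ *-congˡ-≡mod a cb≡1 ⟨
  a * (c * b)    ≡⟨ swap a c b ⟩
  b * (c * a)    ≈⟨ *-congˡ-≡mod b ca≡1 ⟩
  b * 1          ≡⟨ *-identityʳ b ⟩
  b              ∎
  where
  open ≡mod-Reasoning m
  swap : ∀ a c b → a * (c * b) ≡ b * (c * a)
  swap = solve-∀

^-inverse-≡1 : ∀ {m a b} n → a * b ≡ 1 mod m → a ^ n ≡ 1 mod m → b ^ n ≡ 1 mod m
^-inverse-≡1 {m} {a} {b} n ab≡1 aⁿ≡1 = begin
  b ^ n            ≡⟨ *-identityʳ (b ^ n) ⟨
  b ^ n * 1        ≈⟨ *-congˡ-≡mod (b ^ n) aⁿ≡1 ⟨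
  b ^ n * a ^ n    ≡⟨ ^-distrib-* b a n ⟨
  (b * a) ^ n      ≈⟨ ^-cong-≡mod n (subst (_≡ 1 mod m) (*-comm a b) ab≡1) ⟩
  1 ^ n            ≡⟨ ^-zeroˡ n ⟩
  1                ∎
  where open ≡mod-Reasoning m

^-periodic : ∀ {m i Q} n q → i ^ Q ≡ 1 mod m → i ^ (n + Q * q) ≡ i ^ n mod m
^-periodic {m} {i} {Q} n q iᵠ≡1 = begin
  i ^ (n + Q * q)          ≡⟨ ^-distribˡ-+-* i n (Q * q) ⟩
  i ^ n * i ^ (Q * q)      ≡⟨ cong (i ^ n *_) (^-*-assoc i Q q) ⟨
  i ^ n * (i ^ Q) ^ q      ≈⟨ *-congˡ-≡mod (i ^ n) (^-cong-≡mod q iᵠ≡1) ⟩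
  i ^ n * 1 ^ q            ≡⟨ cong (i ^ n *_) (^-zeroˡ q) ⟩
  i ^ n * 1                ≡⟨ *-identityʳ (i ^ n) ⟩
  i ^ n                    ∎
  where open ≡mod-Reasoning m

^2^-suc : ∀ x h → x ^ 2 ^ suc h ≡ x ^ 2 ^ h * x ^ 2 ^ h
^2^-suc x h = trans (^-distribˡ-+-* x (2 ^ h) (2 ^ h + 0)) (cong (λ e → x ^ 2 ^ h * x ^ e) (+-identityʳ (2 ^ h)))

square-≡1 : ∀ {m y} → y ≡ 1 mod 2 * m → y * y ≡ 1 mod 2 * (2 * m)
square-≡1 {m} {y} (mk≡mod k l e) = mk≡mod (y * k + k * k * m) (l + l * l * m) (begin
  y * y + (y * k + k * k * m) * (2 * (2 * m))   ≡⟨ expand y k m ⟨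
  (y + k * (2 * m)) * (y + k * (2 * m))         ≡⟨ cong (λ z → z * z) e ⟩
  (1 + l * (2 * m)) * (1 + l * (2 * m))         ≡⟨ expand 1 l m ⟩
  1 * 1 + (1 * l + l * l * m) * (2 * (2 * m))   ≡⟨ cong (λ z → 1 + (z + l * l * m) * (2 * (2 * m))) (*-identityˡ l) ⟩
  1 + (l + l * l * m) * (2 * (2 * m))           ∎)
  where
  open ≡-Reasoning
  expand : ∀ y k m → (y + k * (2 * m)) * (y + k * (2 * m)) ≡ y * y + (y * k + k * k * m) * (2 * (2 * m))
  expand = solve-∀

periodic : ∀ {u p} (f : ℕ → ℕ) → (∀ i → u ≤ i → f (i + p) ≡ f i) → ∀ {i} n → u ≤ i → f (i + p * n) ≡ f i
periodic {u} {p} f f-per {i} zero    _   = cong f (trans (cong (i +_) (*-zeroʳ p)) (+-identityʳ i))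
periodic {u} {p} f f-per {i} (suc n) u≤i = begin
  f (i + p * suc n)   ≡⟨ cong f (shift i p n) ⟩
  f (i + p * n + p)   ≡⟨ f-per (i + p * n) (≤-trans u≤i (m≤m+n i (p * n))) ⟩
  f (i + p * n)       ≡⟨ periodic f f-per n u≤i ⟩
  f i                 ∎
  where
  open ≡-Reasoning
  shift : ∀ i p n → i + p * suc n ≡ i + p * n + p
  shift = solve-∀

-- Binary digits and truncations

sumTo-cong : ∀ L {f g : ℕ → ℕ} → (∀ e → e < L → f e ≡ g e) → sumTo L f ≡ sumTo L g
sumTo-cong zero    _   = refl
sumTo-cong (suc L) f≡g = cong₂ _+_ (sumTo-cong L (λ e e<L → f≡g e (m<n⇒m<1+n e<L))) (f≡g L ≤-refl)

sumTo-≡mod : ∀ {m} L {f g : ℕ → ℕ} → (∀ e → e < L → f e ≡ g e mod m) → sumTo L f ≡ sumTo L g mod m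
sumTo-≡mod zero    _   = ≡⇒≡mod refl
sumTo-≡mod (suc L) f≡g = +-cong-≡mod (sumTo-≡mod L (λ e e<L → f≡g e (m<n⇒m<1+n e<L))) (f≡g L ≤-refl)

sumTo-zero : ∀ L {f : ℕ → ℕ} → (∀ e → e < L → f e ≡ 0) → sumTo L f ≡ 0
sumTo-zero L f≡0 = trans (sumTo-cong L f≡0) (zeros L)
  where
  zeros : ∀ L → sumTo L (λ _ → 0) ≡ 0
  zeros zero    = refl
  zeros (suc L) = cong (_+ 0) (zeros L)

sumTo-+ : ∀ a b (f : ℕ → ℕ) → sumTo (a + b) f ≡ sumTo a f + sumTo b (λ e → f (a + e))
sumTo-+ a zero    f = trans (cong (λ n → sumTo n f) (+-identityʳ a)) (sym (+-identityʳ _))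
sumTo-+ a (suc b) f = begin
  sumTo (a + suc b) f                                         ≡⟨ cong (λ n → sumTo n f) (+-suc a b) ⟩
  sumTo (a + b) f + f (a + b)                                 ≡⟨ cong (_+ f (a + b)) (sumTo-+ a b f) ⟩
  sumTo a f + sumTo b (λ e → f (a + e)) + f (a + b)           ≡⟨ +-assoc (sumTo a f) _ _ ⟩
  sumTo a f + (sumTo b (λ e → f (a + e)) + f (a + b))         ∎
  where open ≡-Reasoning

*-distribˡ-sumTo : ∀ c L (f : ℕ → ℕ) → c * sumTo L f ≡ sumTo L (λ e → c * f e)
*-distribˡ-sumTo c zero    f = *-zeroʳ c
*-distribˡ-sumTo c (suc L) f = trans (*-distribˡ-+ c (sumTo L f) (f L)) (cong (_+ c * f L) (*-distribˡ-sumTo c L f))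

bit<2 : ∀ n e → bit n e < 2
bit<2 n e = m%n<n (_/_ n (2 ^ e) {{m^n≢0 2 e}}) 2

bit-zeroˡ : ∀ e → bit 0 e ≡ 0
bit-zeroˡ e = cong (_% 2) (0/n≡0 (2 ^ e) {{m^n≢0 2 e}})

module _ (a j : ℕ) where
  private instance
    _ = m^n≢0 2 j
    _ = m^n≢0 2 (suc j)

  bit≡%/ : bit a j ≡ a % 2 ^ suc j / 2 ^ j
  bit≡%/ = sym (m%[n*o]/o≡m/o%n a 2 (2 ^ j))

≡mod⇒bit≡ : ∀ {a b L e} → e < L → a ≡ b mod 2 ^ L → bit a e ≡ bit b e
≡mod⇒bit≡ {a} {b} {L} {e} e<L a≡b = begin
  bit a e                     ≡⟨ bit≡%/ a e ⟩
  a % 2 ^ suc e / 2 ^ e       ≡⟨ cong (_/ 2 ^ e) (≡mod⇒%≡ (≡mod-2^-weaken e<L a≡b)) ⟩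
  b % 2 ^ suc e / 2 ^ e       ≡⟨ bit≡%/ b e ⟨
  bit b e                     ∎
  where open ≡-Reasoning
        instance _ = m^n≢0 2 e
                 _ = m^n≢0 2 (suc e)

mod2^-suc : ∀ a N → mod2^ a (suc N) ≡ mod2^ a N + bit a N * 2 ^ N
mod2^-suc a N = begin
  a % 2 ^ suc N                                       ≡⟨ m≡m%n+[m/n]*n (a % 2 ^ suc N) (2 ^ N) ⟩
  a % 2 ^ suc N % 2 ^ N + a % 2 ^ suc N / 2 ^ N * 2 ^ N ≡⟨ cong₂ (λ r q → r + q * 2 ^ N)
                                                          (m∣n⇒o%n%m≡o%m (2 ^ N) (2 ^ suc N) a (divides 2 refl))
                                                          (sym (bit≡%/ a N)) ⟩
  a % 2 ^ N + bit a N * 2 ^ N                         ∎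
  where open ≡-Reasoning
        instance _ = m^n≢0 2 N
                 _ = m^n≢0 2 (suc N)

trunc-ι : ∀ n N → trunc (ι n) N ≡ mod2^ n N
trunc-ι n zero    = sym (n%1≡0 n)
trunc-ι n (suc N) = trans (cong (_+ bit n N * 2 ^ N) (trunc-ι n N)) (sym (mod2^-suc n N))

bit-+-low : ∀ x c y {e} → e < c → bit (x + 2 ^ c * y) e ≡ bit x e
bit-+-low x c y e<c = ≡mod⇒bit≡ e<c (+m*≡ x y)

module _ {x c : ℕ} where
  private instance _ = m^n≢0 2 c

  /-+-2^* : ∀ y → x < 2 ^ c → (x + 2 ^ c * y) / 2 ^ c ≡ y
  /-+-2^* y x<2^c = begin
    (x + 2 ^ c * y) / 2 ^ c          ≡⟨ cong (λ z → (x + z) / 2 ^ c) (*-comm (2 ^ c) y) ⟩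
    (x + y * 2 ^ c) / 2 ^ c          ≡⟨ +-distrib-/-∣ʳ x (divides y refl) ⟩
    x / 2 ^ c + y * 2 ^ c / 2 ^ c    ≡⟨ cong₂ _+_ (m<n⇒m/n≡0 x<2^c) (m*n/n≡m y (2 ^ c)) ⟩
    y                                ∎
    where open ≡-Reasoning

bit-+-high : ∀ {x} c y e → x < 2 ^ c → bit (x + 2 ^ c * y) (c + e) ≡ bit y e
bit-+-high {x} c y e x<2^c = cong (_% 2) (begin
  (x + 2 ^ c * y) / 2 ^ (c + e)          ≡⟨ /-congʳ (^-distribˡ-+-* 2 c e) ⟩
  (x + 2 ^ c * y) / (2 ^ c * 2 ^ e)      ≡⟨ m/n/o≡m/[n*o] _ (2 ^ c) (2 ^ e) ⟨
  (x + 2 ^ c * y) / 2 ^ c / 2 ^ e        ≡⟨ cong (_/ 2 ^ e) (/-+-2^* {x} {c} y x<2^c) ⟩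
  y / 2 ^ e                              ∎)
  where open ≡-Reasoning
        instance _ = m^n≢0 2 c
                 _ = m^n≢0 2 e
                 _ = m^n≢0 2 (c + e)
                 _ = m*n≢0 (2 ^ c) (2 ^ e)

popBelow-+-low : ∀ x c y {e} → e ≤ c → popBelow (x + 2 ^ c * y) e ≡ popBelow x e
popBelow-+-low x c y e≤c = sumTo-cong _ (λ e′ e′<e → bit-+-low x c y (<-≤-trans e′<e e≤c))

popBelow-+-high : ∀ {x} c y e → x < 2 ^ c → popBelow (x + 2 ^ c * y) (c + e) ≡ popBelow x c + popBelow y e
popBelow-+-high {x} c y e x<2^c = trans (sumTo-+ c e _)
  (cong₂ _+_ (popBelow-+-low x c y ≤-refl) (sumTo-cong e (λ e′ _ → bit-+-high c y e′ x<2^c)))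

n<2^n : ∀ n → n < 2 ^ n
n<2^n zero    = s≤s z≤n
n<2^n (suc n) = subst (_≤ 2 ^ suc n) (+-comm (suc n) 1) (+-mono-≤ (n<2^n n) (subst (1 ≤_) (sym (+-identityʳ (2 ^ n))) (m^n>0 2 n)))

trunc-cong : ∀ {x y : ℤ₂} N → (∀ k → k < N → x k ≡ y k) → trunc x N ≡ trunc y N
trunc-cong N x≡y = sumTo-cong N (λ k k<N → cong (_* 2 ^ k) (x≡y k k<N))

trunc-+ : ∀ (x : ℤ₂) c M → trunc x (c + M) ≡ trunc x c + 2 ^ c * trunc (R c x) M
trunc-+ x c M = trans (sumTo-+ c M _) (cong (trunc x c +_) (trans
  (sumTo-cong M (λ e _ → trans (cong (x (c + e) *_) (^-distribˡ-+-* 2 c e)) (swap (x (c + e)) (2 ^ c) (2 ^ e))))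
  (sym (*-distribˡ-sumTo (2 ^ c) M (λ e → x (c + e) * 2 ^ e)))))
  where swap : ∀ a P Q → a * (P * Q) ≡ P * (a * Q)
        swap = solve-∀

trunc<2^ : ∀ {x : ℤ₂} N → (∀ k → x k < 2) → trunc x N < 2 ^ N
trunc<2^ zero    _     = s≤s z≤n
trunc<2^ {x} (suc N) x<2 = begin-strict
  trunc x N + x N * 2 ^ N  <⟨ +-monoˡ-< _ (trunc<2^ N x<2) ⟩
  2 ^ N + x N * 2 ^ N      ≤⟨ +-monoʳ-≤ (2 ^ N) (*-monoˡ-≤ (2 ^ N) (≤-pred (x<2 N))) ⟩
  2 ^ N + 1 * 2 ^ N        ≡⟨⟩
  2 ^ suc N                ∎
  where open ≤-Reasoning

trunc-R-≡mod : ∀ {x y : ℤ₂} c M z → (∀ k → x k < 2) → (∀ k → y k < 2) →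
               trunc x (c + M) ≡ trunc y (c + M) + 2 ^ c * z mod 2 ^ (c + M) →
               trunc (R c x) M ≡ trunc (R c y) M + z mod 2 ^ M
trunc-R-≡mod {x} {y} c M z x<2 y<2 eq =
  proj₂ (≡mod-radix {{m^n≢0 2 c}} (trunc<2^ c x<2) (trunc<2^ c y<2)
    (≡mod-modulus (^-distribˡ-+-* 2 c M)
      (subst₂ (λ a b → a ≡ b mod 2 ^ (c + M)) (trunc-+ x c M) y-split eq)))
  where
  y-split : trunc y (c + M) + 2 ^ c * z ≡ trunc y c + 2 ^ c * (trunc (R c y) M + z)
  y-split = begin
    trunc y (c + M) + 2 ^ c * z                        ≡⟨ cong (_+ 2 ^ c * z) (trunc-+ y c M) ⟩
    trunc y c + 2 ^ c * trunc (R c y) M + 2 ^ c * z    ≡⟨ +-assoc (trunc y c) _ _ ⟩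
    trunc y c + (2 ^ c * trunc (R c y) M + 2 ^ c * z)  ≡⟨ cong (trunc y c +_) (*-distribˡ-+ (2 ^ c) _ z) ⟨
    trunc y c + 2 ^ c * (trunc (R c y) M + z)          ∎
    where open ≡-Reasoning

-- Φ modulo powers of 2

-- phiMod N n is the residue of -phiSum (inv3 N) n n modulo 2^N.
phiSum : ℕ → ℕ → ℕ → ℕ
phiSum i L n = sumTo L (λ e → bit n e * 2 ^ e * i ^ popBelow n e)

phiSum-split : ∀ i {x} c M y → x < 2 ^ c →
               phiSum i (c + M) (x + 2 ^ c * y) ≡ phiSum i c x + 2 ^ c * (i ^ popBelow x c * phiSum i M y)
phiSum-split i {x} c M y x<2^c = begin
  phiSum i (c + M) X
    ≡⟨ sumTo-+ c M _ ⟩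
  phiSum i c X + sumTo M (λ e → bit X (c + e) * 2 ^ (c + e) * i ^ popBelow X (c + e))
    ≡⟨ cong₂ _+_ (sumTo-cong c low) (sumTo-cong M high) ⟩
  phiSum i c x + sumTo M (λ e → 2 ^ c * i ^ K * term e)
    ≡⟨ cong (phiSum i c x +_) (*-distribˡ-sumTo (2 ^ c * i ^ K) M term) ⟨
  phiSum i c x + 2 ^ c * i ^ K * phiSum i M y
    ≡⟨ cong (phiSum i c x +_) (*-assoc (2 ^ c) (i ^ K) _) ⟩
  phiSum i c x + 2 ^ c * (i ^ K * phiSum i M y) ∎
  where
  open ≡-Reasoning
  X K : ℕ
  X = x + 2 ^ c * y
  K = popBelow x c
  term : ℕ → ℕ
  term e = bit y e * 2 ^ e * i ^ popBelow y e
  low : ∀ e → e < c → bit X e * 2 ^ e * i ^ popBelow X e ≡ bit x e * 2 ^ e * i ^ popBelow x e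
  low e e<c = cong₂ (λ d p → d * 2 ^ e * i ^ p) (bit-+-low x c y e<c) (popBelow-+-low x c y (<⇒≤ e<c))
  rearrange : ∀ d P Q I J → d * (P * Q) * (I * J) ≡ P * I * (d * Q * J)
  rearrange = solve-∀
  high : ∀ e → e < M → bit X (c + e) * 2 ^ (c + e) * i ^ popBelow X (c + e) ≡ 2 ^ c * i ^ K * term e
  high e _ = begin
    bit X (c + e) * 2 ^ (c + e) * i ^ popBelow X (c + e)
      ≡⟨ cong₂ (λ d p → d * 2 ^ (c + e) * i ^ p) (bit-+-high c y e x<2^c) (popBelow-+-high c y e x<2^c) ⟩
    bit y e * 2 ^ (c + e) * i ^ (K + popBelow y e)
      ≡⟨ cong₂ (λ P I → bit y e * P * I) (^-distribˡ-+-* 2 c e) (^-distribˡ-+-* i K (popBelow y e)) ⟩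
    bit y e * (2 ^ c * 2 ^ e) * (i ^ K * i ^ popBelow y e)
      ≡⟨ rearrange (bit y e) (2 ^ c) (2 ^ e) (i ^ K) (i ^ popBelow y e) ⟩
    2 ^ c * i ^ K * term e ∎

phiSum-zeroʳ : ∀ i L → phiSum i L 0 ≡ 0
phiSum-zeroʳ i L = sumTo-zero L (λ e _ → cong (λ d → d * 2 ^ e * i ^ popBelow 0 e) (bit-zeroˡ e))

phiSum-extend : ∀ i {x} c d → x < 2 ^ c → phiSum i (c + d) x ≡ phiSum i c x
phiSum-extend i {x} c d x<2^c = begin
  phiSum i (c + d) x                                           ≡⟨ cong (phiSum i (c + d)) x≡x+2^c*0 ⟩
  phiSum i (c + d) (x + 2 ^ c * 0)                             ≡⟨ phiSum-split i c d 0 x<2^c ⟩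
  phiSum i c x + 2 ^ c * (i ^ popBelow x c * phiSum i d 0)     ≡⟨ cong (λ s → phiSum i c x + 2 ^ c * (i ^ popBelow x c * s)) (phiSum-zeroʳ i d) ⟩
  phiSum i c x + 2 ^ c * (i ^ popBelow x c * 0)                ≡⟨ cong (λ s → phiSum i c x + 2 ^ c * s) (*-zeroʳ (i ^ popBelow x c)) ⟩
  phiSum i c x + 2 ^ c * 0                                     ≡⟨ x≡x+2^c*0 ⟨
  phiSum i c x                                                 ∎
  where
  open ≡-Reasoning
  x≡x+2^c*0 : ∀ {a} → a ≡ a + 2 ^ c * 0
  x≡x+2^c*0 {a} = sym (trans (cong (a +_) (*-zeroʳ (2 ^ c))) (+-identityʳ a))

phiSum-truncate : ∀ i n {M N} → M ≤ N → phiSum i N n ≡ phiSum i M n mod 2 ^ M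
phiSum-truncate i n {M} M≤N with m≤n⇒∃[o]m+o≡n M≤N
... | d , refl = begin
  phiSum i (M + d) n                                       ≡⟨ sumTo-+ M d _ ⟩
  phiSum i M n + sumTo d (λ e → bit n (M + e) * 2 ^ (M + e) * I (M + e))
     ≡⟨ cong (phiSum i M n +_) (trans (sumTo-cong d (λ e _ → factor e)) (sym (*-distribˡ-sumTo (2 ^ M) d _))) ⟩
  phiSum i M n + 2 ^ M * sumTo d (λ e → bit n (M + e) * 2 ^ e * I (M + e)) ≈⟨ +m*≡ (phiSum i M n) _ ⟩
  phiSum i M n                                             ∎
  where
  open ≡mod-Reasoning (2 ^ M)
  I : ℕ → ℕ
  I e = i ^ popBelow n e
  rearrange : ∀ d P Q J → d * (P * Q) * J ≡ P * (d * Q * J)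
  rearrange = solve-∀
  factor : ∀ e → bit n (M + e) * 2 ^ (M + e) * I (M + e) ≡ 2 ^ M * (bit n (M + e) * 2 ^ e * I (M + e))
  factor e = trans (cong (λ P → bit n (M + e) * P * I (M + e)) (^-distribˡ-+-* 2 M e))
                   (rearrange (bit n (M + e)) (2 ^ M) (2 ^ e) (I (M + e)))

phiSum-full : ∀ i n N → phiSum i n n ≡ phiSum i N n mod 2 ^ N
phiSum-full i n N = begin
  phiSum i n n         ≡⟨ phiSum-extend i n N (n<2^n n) ⟨
  phiSum i (n + N) n   ≈⟨ phiSum-truncate i n (m≤n+m N n) ⟩
  phiSum i N n         ∎
  where open ≡mod-Reasoning (2 ^ N)

phiSum-cong-base : ∀ {m i i′} L n → i ≡ i′ mod m → phiSum i L n ≡ phiSum i′ L n mod m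
phiSum-cong-base L n i≡i′ = sumTo-≡mod L (λ e _ → *-congˡ-≡mod (bit n e * 2 ^ e) (^-cong-≡mod (popBelow n e) i≡i′))

phiSum-cong-arg : ∀ i L {n n′} → n ≡ n′ mod 2 ^ L → phiSum i L n ≡ phiSum i L n′
phiSum-cong-arg i L n≡n′ = sumTo-cong L (λ e e<L → cong₂ (λ d p → d * 2 ^ e * i ^ p)
  (≡mod⇒bit≡ e<L n≡n′) (sumTo-cong e (λ e′ e′<e → ≡mod⇒bit≡ (<-trans e′<e e<L) n≡n′)))

3∣2*4^N+1 : ∀ N → 3 ∣ 2 * 4 ^ N + 1
3∣2*4^N+1 zero    = divides 1 refl
3∣2*4^N+1 (suc N) = subst (3 ∣_) (split (4 ^ N)) (∣m∣n⇒∣m+n (3∣2*4^N+1 N) (m∣m*n (2 * 4 ^ N)))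
  where split : ∀ F → 2 * F + 1 + 3 * (2 * F) ≡ 2 * (4 * F) + 1
        split = solve-∀

3*inv3≡1 : ∀ N → 3 * inv3 N ≡ 1 mod 2 ^ N
3*inv3≡1 N = mk≡mod 0 (2 * 2 ^ N) (begin
  3 * inv3 N + 0 * 2 ^ N       ≡⟨ +-identityʳ _ ⟩
  3 * inv3 N                   ≡⟨ m*[n/m]≡n (3∣2*4^N+1 N) ⟩
  2 * 4 ^ N + 1                ≡⟨ cong (λ F → 2 * F + 1) (^-distrib-* 2 2 N) ⟩
  2 * (2 ^ N * 2 ^ N) + 1      ≡⟨ regroup (2 ^ N) ⟩
  1 + 2 * 2 ^ N * 2 ^ N        ∎)
  where
  open ≡-Reasoning
  regroup : ∀ P → 2 * (P * P) + 1 ≡ 1 + 2 * P * P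
  regroup = solve-∀

inv3-≡mod : ∀ {M N} → M ≤ N → inv3 N ≡ inv3 M mod 2 ^ M
inv3-≡mod {M} {N} M≤N = inverse-unique-≡mod {c = 3} (≡mod-2^-weaken M≤N (3*inv3≡1 N)) (3*inv3≡1 M)

3^2^[1+h]≡1 : ∀ h → 3 ^ 2 ^ suc h ≡ 1 mod 2 ^ (suc h + 2)
3^2^[1+h]≡1 zero    = mk≡mod 0 1 refl
3^2^[1+h]≡1 (suc h) = subst (_≡ 1 mod 2 ^ (suc (suc h) + 2)) (sym (^2^-suc 3 (suc h))) (square-≡1 {2 ^ (h + 2)} (3^2^[1+h]≡1 h))

inv3^2^[1+h]≡1 : ∀ h → inv3 (suc h + 2) ^ 2 ^ suc h ≡ 1 mod 2 ^ (suc h + 2)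
inv3^2^[1+h]≡1 h = ^-inverse-≡1 (2 ^ suc h) (3*inv3≡1 (suc h + 2)) (3^2^[1+h]≡1 h)

phiMod-spec : ∀ N n → phiMod N n + phiSum (inv3 N) N n ≡ 0 mod 2 ^ N
phiMod-spec N n = begin
  phiMod N n + phiSum (inv3 N) N n  ≈⟨ +-cong-≡mod (%≡mod (2 ^ N ∸ r)) (≡mod-sym (phiSum-full (inv3 N) n N)) ⟩
  (2 ^ N ∸ r) + s                   ≈⟨ +-cong-≡mod (≡⇒≡mod refl) (%≡mod s) ⟨
  (2 ^ N ∸ r) + r                   ≡⟨ m∸n+n≡m (<⇒≤ (m%n<n s (2 ^ N))) ⟩
  2 ^ N                             ≡⟨ *-identityʳ (2 ^ N) ⟨
  2 ^ N * 1                         ≈⟨ m*≡0 1 ⟩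
  0                                 ∎
  where
  open ≡mod-Reasoning (2 ^ N)
  instance _ = m^n≢0 2 N
  s r : ℕ
  s = phiSum (inv3 N) n n
  r = mod2^ s N

phiMod-unique : ∀ N n {r} → r + phiSum (inv3 N) N n ≡ 0 mod 2 ^ N → r ≡ phiMod N n mod 2 ^ N
phiMod-unique N n r+s≡0 = +-cancelʳ-≡mod _ (≡mod-trans r+s≡0 (≡mod-sym (phiMod-spec N n)))

phiMod-cong : ∀ {M N n n′} → M ≤ N → n ≡ n′ mod 2 ^ M → phiMod M n ≡ phiMod N n′ mod 2 ^ M
phiMod-cong {M} {N} {n} {n′} M≤N n≡n′ = ≡mod-sym (phiMod-unique M n (begin
  phiMod N n′ + phiSum (inv3 M) M n   ≡⟨ cong (phiMod N n′ +_) (phiSum-cong-arg (inv3 M) M n≡n′) ⟩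
  phiMod N n′ + phiSum (inv3 M) M n′  ≈⟨ +-cong-≡mod (≡⇒≡mod refl) (phiSum-cong-base M n′ (inv3-≡mod M≤N)) ⟨
  phiMod N n′ + phiSum (inv3 N) M n′  ≈⟨ +-cong-≡mod (≡⇒≡mod refl) (phiSum-truncate (inv3 N) n′ M≤N) ⟨
  phiMod N n′ + phiSum (inv3 N) N n′  ≈⟨ ≡mod-2^-weaken M≤N (phiMod-spec N n′) ⟩
  0                                   ∎))
  where open ≡mod-Reasoning (2 ^ M)

phiMod-split : ∀ {x} c M y → x < 2 ^ c →
               phiMod (c + M) (x + 2 ^ c * y) ≡ phiMod (c + M) x + 2 ^ c * (inv3 M ^ popBelow x c * phiMod M y) mod 2 ^ (c + M)
phiMod-split {x} c M y x<2^c = ≡mod-sym (phiMod-unique (c + M) (x + 2 ^ c * y) (begin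
  φx + 2 ^ c * (j ^ K * φy) + phiSum i N (x + 2 ^ c * y)
    ≡⟨ cong (φx + 2 ^ c * (j ^ K * φy) +_) (phiSum-split i c M y x<2^c) ⟩
  φx + 2 ^ c * (j ^ K * φy) + (phiSum i c x + 2 ^ c * (i ^ K * phiSum i M y))
    ≡⟨ regroup φx (2 ^ c) (j ^ K * φy) (phiSum i c x) (i ^ K * phiSum i M y) ⟩
  (φx + phiSum i c x) + 2 ^ c * (j ^ K * φy + i ^ K * phiSum i M y)
    ≡⟨ cong (λ s → φx + s + 2 ^ c * (j ^ K * φy + i ^ K * phiSum i M y)) (phiSum-extend i c M x<2^c) ⟨
  (φx + phiSum i N x) + 2 ^ c * (j ^ K * φy + i ^ K * phiSum i M y)
    ≈⟨ +-cong-≡mod (phiMod-spec N x) (≡mod-2^-lift c high≡0) ⟩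
  0 + 2 ^ c * 0
    ≡⟨ *-zeroʳ (2 ^ c) ⟩
  0 ∎))
  where
  N i j K φx φy : ℕ
  N = c + M
  i = inv3 N
  j = inv3 M
  K = popBelow x c
  φx = phiMod N x
  φy = phiMod M y
  regroup : ∀ a P u b w → a + P * u + (b + P * w) ≡ (a + b) + P * (u + w)
  regroup = solve-∀
  open ≡mod-Reasoning (2 ^ N)
  i≡j : i ≡ j mod 2 ^ M
  i≡j = inv3-≡mod (m≤n+m M c)
  high≡0 : j ^ K * φy + i ^ K * phiSum i M y ≡ 0 mod 2 ^ M
  high≡0 =
    ≡mod-trans (+-cong-≡mod (≡⇒≡mod refl) (*-cong-≡mod (^-cong-≡mod K i≡j) (phiSum-cong-base M y i≡j)))
      (≡mod-trans (≡⇒≡mod (sym (*-distribˡ-+ (j ^ K) φy (phiSum j M y))))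
        (≡mod-trans (*-congˡ-≡mod (j ^ K) (phiMod-spec M y))
          (≡⇒≡mod (*-zeroʳ (j ^ K)))))

Φ-digit<2 : ∀ x k → Φ x k < 2
Φ-digit<2 x k = bit<2 _ k

trunc-R-Φ<2^ : ∀ c x M → trunc (R c (Φ x)) M < 2 ^ M
trunc-R-Φ<2^ c x M = trunc<2^ {R c (Φ x)} M (λ j → Φ-digit<2 x (c + j))

trunc-Φ : ∀ (x : ℤ₂) n N → (∀ k → k < N → x k ≡ bit n k) → trunc (Φ x) N ≡ phiMod N n
trunc-Φ x n N x≡n = begin
  trunc (Φ x) N                  ≡⟨ trunc-cong N digit ⟩
  trunc (ι (phiMod N n)) N       ≡⟨ trunc-ι (phiMod N n) N ⟩
  mod2^ (phiMod N n) N           ≡⟨ m%n%n≡m%n _ (2 ^ N) {{m^n≢0 2 N}} ⟩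
  phiMod N n                     ∎
  where
  open ≡-Reasoning
  prefix : ∀ j → j < N → trunc x (suc j) ≡ n mod 2 ^ suc j
  prefix j j<N = subst (_≡ n mod 2 ^ suc j)
    (sym (trans (trunc-cong (suc j) (λ k k≤j → x≡n k (<-≤-trans k≤j j<N))) (trunc-ι n (suc j))))
    (%≡mod {{m^n≢0 2 (suc j)}} n)
  digit : ∀ j → j < N → Φ x j ≡ bit (phiMod N n) j
  digit j j<N = ≡mod⇒bit≡ (n<1+n j) (phiMod-cong j<N (prefix j j<N))

trunc-Φ-ι : ∀ n N → trunc (Φ (ι n)) N ≡ phiMod N n
trunc-Φ-ι n N = trunc-Φ (ι n) n N (λ _ _ → refl)

-- The numbers b̄_{v,t} and b̄_{v,∞}

barFin-+ : ∀ b v t s → barFin b v (t + s) ≡ barFin b v t + 2 ^ (t * v) * barFin b v s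
barFin-+ b v t s = begin
  b * sumTo (t + s) g                                           ≡⟨ cong (b *_) (sumTo-+ t s g) ⟩
  b * (sumTo t g + sumTo s (λ e → g (t + e)))                   ≡⟨ cong (λ z → b * (sumTo t g + z)) shifted ⟩
  b * (sumTo t g + 2 ^ (t * v) * sumTo s g)                     ≡⟨ distrib b (sumTo t g) (2 ^ (t * v)) (sumTo s g) ⟩
  b * sumTo t g + 2 ^ (t * v) * (b * sumTo s g)                 ∎
  where
  open ≡-Reasoning
  g : ℕ → ℕ
  g i = 2 ^ (v * i)
  shifted : sumTo s (λ e → g (t + e)) ≡ 2 ^ (t * v) * sumTo s g
  shifted = trans (sumTo-cong s (λ e _ → trans (cong (2 ^_) (trans (*-distribˡ-+ v t e) (cong (_+ v * e) (*-comm v t))))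
                                                (^-distribˡ-+-* 2 (t * v) (v * e))))
                  (sym (*-distribˡ-sumTo (2 ^ (t * v)) s g))
  distrib : ∀ b A P B → b * (A + P * B) ≡ b * A + P * (b * B)
  distrib = solve-∀

barFin-suc : ∀ b v t → barFin b v (suc t) ≡ barFin b v t + 2 ^ (t * v) * b
barFin-suc b v t = trans (*-distribˡ-+ b _ _) (cong (barFin b v t +_) (trans (*-comm b _) (cong (λ e → 2 ^ e * b) (*-comm v t))))

barFin<2^ : ∀ {b v} t → b < 2 ^ v → barFin b v t < 2 ^ (t * v)
barFin<2^ {b} zero    _     = subst (_< 1) (sym (*-zeroʳ b)) (s≤s z≤n)
barFin<2^ {b} {v} (suc t) b<2^v = begin-strict
  barFin b v (suc t)         ≡⟨ barFin-suc b v t ⟩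
  barFin b v t + P * b       <⟨ +-monoˡ-< (P * b) (barFin<2^ t b<2^v) ⟩
  P + P * b                  ≡⟨ cong (_+ P * b) (*-identityʳ P) ⟨
  P * 1 + P * b              ≡⟨ *-distribˡ-+ P 1 b ⟨
  P * suc b                  ≤⟨ *-monoʳ-≤ P b<2^v ⟩
  P * 2 ^ v                  ≡⟨ trans (*-comm P _) (sym (^-distribˡ-+-* 2 v (t * v))) ⟩
  2 ^ (suc t * v)            ∎
  where
  open ≤-Reasoning
  P : ℕ
  P = 2 ^ (t * v)

popBelow-barFin : ∀ {b v} t → b < 2 ^ v → popBelow (barFin b v t) (t * v) ≡ t * popBelow b v
popBelow-barFin zero    _ = refl
popBelow-barFin {b} {v} (suc t) b<2^v = begin
  popBelow (barFin b v (suc t)) (v + t * v)                 ≡⟨ cong₂ popBelow (barFin-suc b v t) (+-comm v (t * v)) ⟩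
  popBelow (barFin b v t + 2 ^ (t * v) * b) (t * v + v)     ≡⟨ popBelow-+-high (t * v) b v (barFin<2^ t b<2^v) ⟩
  popBelow (barFin b v t) (t * v) + popBelow b v            ≡⟨ cong (_+ popBelow b v) (popBelow-barFin t b<2^v) ⟩
  t * popBelow b v + popBelow b v                           ≡⟨ +-comm (t * popBelow b v) _ ⟩
  suc t * popBelow b v                                      ∎
  where open ≡-Reasoning

barInf-digit : ∀ {b v k s} → 1 ≤ v → k < s → barInf b v k ≡ bit (barFin b v s) k
barInf-digit {b} {v} {k} v≥1 k<s with m≤n⇒∃[o]m+o≡n k<s
... | d , refl = sym (trans (cong (λ n → bit n k) (barFin-+ b v (suc k) d))
                            (bit-+-low (barFin b v (suc k)) (suc k * v) (barFin b v d) k<[1+k]v))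
  where
  k<[1+k]v : k < suc k * v
  k<[1+k]v = <-≤-trans (n<1+n k) (m≤m*n (suc k) v {{>-nonZero v≥1}})

trunc-Φ-barInf : ∀ {b v N s} → 1 ≤ v → N ≤ s → trunc (Φ (barInf b v)) N ≡ phiMod N (barFin b v s)
trunc-Φ-barInf {b} {v} {N} {s} v≥1 N≤s = trunc-Φ (barInf b v) (barFin b v s) N (λ k k<N → barInf-digit {b} v≥1 (<-≤-trans k<N N≤s))

R-Φ-barInf : ∀ {b v} t M → 1 ≤ v → b < 2 ^ v →
             trunc (R (t * v) (Φ (barInf b v))) M
               ≡ trunc (R (t * v) (Φ (ι (barFin b v t)))) M + inv3 M ^ (t * popBelow b v) * trunc (Φ (barInf b v)) M
               mod 2 ^ M
R-Φ-barInf {b} {v} t M v≥1 b<2^v = trunc-R-≡mod {A} {Y} c M _ (Φ-digit<2 (barInf b v)) (Φ-digit<2 (ι x)) (begin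
  trunc A (c + M)                                               ≡⟨ trunc-Φ-barInf {b} {v} v≥1 (m≤n+m (c + M) t) ⟩
  phiMod (c + M) (barFin b v (t + (c + M)))                     ≡⟨ cong (phiMod (c + M)) (barFin-+ b v t (c + M)) ⟩
  phiMod (c + M) (x + 2 ^ c * y)                                ≈⟨ phiMod-split c M y (barFin<2^ t b<2^v) ⟩
  phiMod (c + M) x + 2 ^ c * (inv3 M ^ popBelow x c * phiMod M y)
    ≡⟨ cong₂ (λ z K → z + 2 ^ c * (inv3 M ^ K * phiMod M y)) (sym (trunc-Φ-ι x (c + M))) (popBelow-barFin t b<2^v) ⟩
  trunc Y (c + M) + 2 ^ c * (inv3 M ^ (t * popBelow b v) * phiMod M y)
    ≡⟨ cong (λ z → trunc Y (c + M) + 2 ^ c * (inv3 M ^ (t * popBelow b v) * z)) (trunc-Φ-barInf {b} {v} v≥1 (m≤n+m M c)) ⟨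
  trunc Y (c + M) + 2 ^ c * (inv3 M ^ (t * popBelow b v) * trunc A M) ∎)
  where
  open ≡mod-Reasoning (2 ^ (t * v + M))
  c x y : ℕ
  c = t * v
  x = barFin b v t
  y = barFin b v (c + M)
  A Y : ℤ₂
  A = Φ (barInf b v)
  Y = Φ (ι x)

corollary16 : (v b u p t : ℕ) → 1 ≤ v → b < 2 ^ v → 1 ≤ p
    → (∀ i → u ≤ i → Φ (barInf b v) (i + p) ≡ Φ (barInf b v) i)
    → u ≤ t * v
    → (H : ℕ) → 1 ≤ H
    → R (t * v) (Φ (ι (barFin b v t)))
        ≡₂ R ((t + p * 2 ^ H) * v) (Φ (ι (barFin b v (t + p * 2 ^ H))))
        mod2^ (H + 2)
corollary16 v b u p t v≥1 b<2^v _ A-periodic u≤tv (suc h) _ =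
  ≡mod⇒≡ {{m^n≢0 2 M}} (trunc-R-Φ<2^ (t * v) (ι (barFin b v t)) M) (trunc-R-Φ<2^ (t′ * v) (ι (barFin b v t′)) M)
    (+-cancelʳ-≡mod (w * a) (begin
      trunc (R (t * v) Y) M + w * a     ≈⟨ R-Φ-barInf t M v≥1 b<2^v ⟨
      trunc (R (t * v) A) M             ≡⟨ trunc-cong M A-shift ⟨
      trunc (R (t′ * v) A) M            ≈⟨ R-Φ-barInf t′ M v≥1 b<2^v ⟩
      trunc (R (t′ * v) Y′) M + w′ * a  ≈⟨ +-cong-≡mod (≡⇒≡mod refl) (*-congʳ-≡mod a w′≡w) ⟩
      trunc (R (t′ * v) Y′) M + w * a   ∎))
  where
  open ≡mod-Reasoning (2 ^ (suc h + 2))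
  M Q t′ k a w w′ : ℕ
  M = suc h + 2
  Q = 2 ^ suc h
  t′ = t + p * Q
  k = popBelow b v
  A Y Y′ : ℤ₂
  A = Φ (barInf b v)
  Y = Φ (ι (barFin b v t))
  Y′ = Φ (ι (barFin b v t′))
  a = trunc A M
  w = inv3 M ^ (t * k)
  w′ = inv3 M ^ (t′ * k)
  exponent : ∀ t p Q k → t * k + Q * (p * k) ≡ (t + p * Q) * k
  exponent = solve-∀
  w′≡w : w′ ≡ w mod 2 ^ M
  w′≡w = subst (λ e → inv3 M ^ e ≡ w mod 2 ^ M) (exponent t p Q k) (^-periodic {Q = Q} (t * k) (p * k) (inv3^2^[1+h]≡1 h))
  position : ∀ t p Q v j → t * v + j + p * (Q * v) ≡ (t + p * Q) * v + j
  position = solve-∀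
  A-shift : ∀ j → j < M → A (t′ * v + j) ≡ A (t * v + j)
  A-shift j _ = trans (cong A (sym (position t p Q v j))) (periodic A A-periodic (Q * v) (≤-trans u≤tv (m≤m+n (t * v) j)))
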